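{- Let $G$ be a graph, $A=\{u_1,\dots,u_t\}$ an independent set of $G$, and $\sigma$ the ordering $u_1,u_2,\dots,u_t$ of $A$. Then the graph $\tau(G,A,\sigma)$ is a threshold graph and $G$ is a subgraph of it.
   Context: Let $B=V(G)\setminus A$. For $v\in B$ let $s(v)=\max\{i: u_i\in N_G(v)\}$ if $N_G(v)\cap A\ne\emptyset$, and $s(v)=0$ otherwise. The graph $\tau(G,A,\sigma)$ has vertex set $V(G)$ and edge set $E(G)\cup\{xy: x,y\in B,\ x\ne y\}\cup\bigcup_{v\in B}\{vu_1,vu_2,\dots,vu_{s(v)}\}$ (so $A$ is independent, $B$ is a clique, and each $v\in B$ is adjacent in $A$ exactly to $u_1,\dots,u_{s(v)}$). A graph $H$ on $N$ vertices is a threshold graph if there exist real numbers $a_1,\dots,a_N,b$ such that the $0$-$1$ solutions of $\sum a_ix_i\le b$ are exactly the characteristic vectors of the cliques of $H$ (equivalently, $H$ has no induced $2K_2$, $P_4$ or $C_4$). -}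

module Defs where

open import Data.Nat using (ℕ; zero; suc; _⊔_) renaming (_≤_ to _≤ℕ_)
open import Data.Fin using (Fin; toℕ)
open import Data.Bool using (Bool; true; false; if_then_else_; T)
open import Data.List using (List; foldr; map; allFin)
open import Data.Rational using (ℚ; 0ℚ; _+_; _≤_)
open import Data.Product using (Σ; _×_; ∃)
open import Data.Sum using (_⊎_)
open import Relation.Binary.PropositionalEquality using (_≡_; _≢_)
open import Function.Bundles using (_⇔_)

record Graph (n : ℕ) : Set where
  field
    adj    : Fin n → Fin n → Bool
    sym    : ∀ x y → adj x y ≡ adj y x
    irrefl : ∀ x → adj x x ≡ false
open Graph public

Independent : ∀ {n t} → Graph n → (Fin t → Fin n) → Set
Independent G u = ∀ i j → adj G (u i) (u j) ≡ false

InB : ∀ {n t} → (Fin t → Fin n) → Fin n → Set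
InB u v = ∀ i → u i ≢ v

-- s(v) = max { i : u_i ∈ N_G(v) } (indices 1..t; index j : Fin t stands for u_{j+1}),
-- and 0 if v has no neighbour in A.
s : ∀ {n t} → Graph n → (Fin t → Fin n) → Fin n → ℕ
s {t = t} G u v =
  foldr _⊔_ 0 (map (λ j → if adj G v (u j) then suc (toℕ j) else 0) (allFin t))

-- Adjacency of τ(G,A,σ): E(G) ∪ {xy : x,y ∈ B, x ≠ y} ∪ ⋃_{v∈B} {v u_1,…,v u_{s(v)}}
-- (edges are unordered, so the last family is listed in both orientations).
TauAdj : ∀ {n t} → Graph n → (Fin t → Fin n) → Fin n → Fin n → Set
TauAdj G u x y =
  T (adj G x y)
  ⊎ (InB u x × InB u y × x ≢ y)
  ⊎ (Σ _ λ i → InB u x × y ≡ u i × suc (toℕ i) ≤ℕ s G u x)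
  ⊎ (Σ _ λ i → InB u y × x ≡ u i × suc (toℕ i) ≤ℕ s G u y)

IsClique : ∀ {N} → (Fin N → Fin N → Set) → (Fin N → Bool) → Set
IsClique R x = ∀ i j → i ≢ j → x i ≡ true → x j ≡ true → R i j

weight : ∀ {N} → (Fin N → ℚ) → (Fin N → Bool) → ℚ
weight {N} a x = foldr (λ i acc → (if x i then a i else 0ℚ) + acc) 0ℚ (allFin N)

IsThreshold : ∀ {N} → (Fin N → Fin N → Set) → Set
IsThreshold {N} R =
  Σ (Fin N → ℚ) λ a → Σ ℚ λ b → ∀ (x : Fin N → Bool) → (weight a x ≤ b) ⇔ IsClique R x

IsSubgraphOf : ∀ {n} → Graph n → (Fin n → Fin n → Set) → Set
IsSubgraphOf G R = ∀ x y → T (adj G x y) → R x y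

{-# OPTIONS --safe #-}
-- τ(G,A,σ) is a nested split graph: A is independent, B is a clique, and the
-- neighbourhood of v ∈ B in A is the initial segment u_1,…,u_{s(v)}.  Such a graph
-- is threshold: with D = n + 1 give v ∈ B the weight D^(t - s(v)) and u_i the weight
-- b - n·D^(t - i), where b exceeds twice n·D^t.  Two vertices of A together weigh
-- more than b; u_i together with all its neighbours in B weighs at most b, since
-- each of them weighs at most D^(t - i); and u_i together with a non-neighbour
-- v ∈ B (s(v) < i) weighs more than b, since D^(t - s(v)) ≥ D·D^(t - i) > n·D^(t - i).
module Submission where

open import Defs
open import Data.Nat using (ℕ)
open import Data.Fin using (Fin)
open import Data.Product using (_×_)
open import Function.Definitions using (Injective)
open import Relation.Binary.PropositionalEquality using (_≡_)

open import Data.Nat using (zero; suc; _+_; _*_; _∸_; _^_; _⊔_; _≤_; _<_; z≤n)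
open import Data.Nat.Properties
import Data.Fin as Fin
open import Data.Fin using (toℕ; punchOut)
open import Data.Fin.Properties using (any?; punchIn-punchOut; punchInᵢ≢i; toℕ<n)
  renaming (_≟_ to _≟ᶠ_)
open import Data.Bool using (Bool; true; false; if_then_else_; T)
open import Data.Bool.Properties using (T-≡) renaming (_≟_ to _≟ᵇ_)
open import Data.List using (_∷_; foldr; tabulate)
open import Data.List.Membership.Propositional using (_∈_)
open import Data.List.Membership.Propositional.Properties using (∈-map⁺; ∈-allFin)
open import Data.List.Relation.Unary.Any using (here; there)
open import Data.Integer as ℤ using (+_)
import Data.Integer.Properties as ℤ
open import Data.Integer.Tactic.RingSolver using (solve-∀)
open import Data.Rational as ℚ using (0ℚ)
import Data.Rational.Properties as ℚ
open import Data.Rational.Literals using (fromℤ)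
import Data.Rational.Unnormalised as ℚᵘ
import Data.Rational.Unnormalised.Properties as ℚᵘ
open import Algebra.Properties.CommutativeMonoid.Sum +-0-commutativeMonoid using (sum; sum-remove)
open import Data.Vec.Functional using (removeAt)
open import Data.Product using (∃; _,_)
open import Data.Sum using (_⊎_; inj₁; inj₂)
open import Data.Empty using (⊥; ⊥-elim)
open import Data.Unit using (⊤; tt)
open import Relation.Nullary using (¬_; Dec; yes; no; _×-dec_)
open import Relation.Binary.PropositionalEquality as ≡
  using (_≢_; refl; trans; cong; cong₂; subst; subst₂)
open import Function using (_∘_; id)
open import Function.Bundles using (_⇔_; mk⇔; Equivalence)

open Equivalence using (to; from)

sum-≤-* : ∀ {m c} (f : Fin m → ℕ) → (∀ i → f i ≤ c) → sum f ≤ m * c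
sum-≤-* {zero}  f f≤c = z≤n
sum-≤-* {suc m} f f≤c = +-mono-≤ (f≤c Fin.zero) (sum-≤-* (f ∘ Fin.suc) (f≤c ∘ Fin.suc))

≤-sum : ∀ {m} (f : Fin m → ℕ) i → f i ≤ sum f
≤-sum f Fin.zero    = m≤m+n _ _
≤-sum f (Fin.suc i) = ≤-trans (≤-sum (f ∘ Fin.suc) i) (m≤n+m _ _)

+-≤-sum : ∀ {m} (f : Fin m → ℕ) {i j} → i ≢ j → f i + f j ≤ sum f
+-≤-sum {suc m} f {i} {j} i≢j = begin
  f i + f j                          ≡⟨ cong (λ k → f i + f k) (≡.sym (punchIn-punchOut i≢j)) ⟩
  f i + removeAt f i (punchOut i≢j)  ≤⟨ +-monoʳ-≤ (f i) (≤-sum (removeAt f i) (punchOut i≢j)) ⟩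
  f i + sum (removeAt f i)           ≡⟨ sum-remove f ⟨
  sum f                              ∎
  where open ≤-Reasoning

sum-≤-+* : ∀ {m c} (f : Fin m → ℕ) i → (∀ j → j ≢ i → f j ≤ c) → sum f ≤ f i + m * c
sum-≤-+* {suc m} {c} f i f≤c = begin
  sum f                     ≡⟨ sum-remove f ⟩
  f i + sum (removeAt f i)  ≤⟨ +-monoʳ-≤ (f i) (sum-≤-* (removeAt f i) (λ j → f≤c _ (punchInᵢ≢i i j))) ⟩
  f i + m * c               ≤⟨ +-monoʳ-≤ (f i) (m≤n+m (m * c) c) ⟩
  f i + suc m * c           ∎
  where open ≤-Reasoning

selected : ∀ {N} → (Fin N → Bool) → (Fin N → ℕ) → Fin N → ℕ
selected x w i = if x i then w i else 0

selected-true : ∀ {N} (x : Fin N → Bool) (w : Fin N → ℕ) {i} → x i ≡ true → selected x w i ≡ w i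
selected-true x w {i} xi rewrite xi = refl

selected-≤ : ∀ {N c} (x : Fin N → Bool) (w : Fin N → ℕ) i → (x i ≡ true → w i ≤ c) → selected x w i ≤ c
selected-≤ x w i w≤c with x i
... | true  = w≤c refl
... | false = z≤n

fromℤ-homo-+ : ∀ p q → fromℤ p ℚ.+ fromℤ q ≡ fromℤ (p ℤ.+ q)
fromℤ-homo-+ p q =
  ℚ.toℚᵘ-injective (ℚᵘ.≃-trans (ℚ.toℚᵘ-homo-+ (fromℤ p) (fromℤ q)) (ℚᵘ.*≡* (cross p q)))
  where
  cross : ∀ p q → (p ℤ.* + 1 ℤ.+ q ℤ.* + 1) ℤ.* + 1 ≡ (p ℤ.+ q) ℤ.* + 1
  cross = solve-∀

fromℕ-≤ : ∀ {p q} → (fromℤ (+ p) ℚ.≤ fromℤ (+ q)) ⇔ (p ≤ q)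
fromℕ-≤ {p} {q} = mk⇔
  (λ { (ℚ.*≤* le) → ℤ.drop‿+≤+ (subst₂ ℤ._≤_ (ℤ.*-identityʳ (+ p)) (ℤ.*-identityʳ (+ q)) le) })
  (λ le → ℚ.*≤* (subst₂ ℤ._≤_ (≡.sym (ℤ.*-identityʳ (+ p))) (≡.sym (ℤ.*-identityʳ (+ q))) (ℤ.+≤+ le)))

weight-fromℕ : ∀ {N} (w : Fin N → ℕ) (x : Fin N → Bool) →
               weight (λ i → fromℤ (+ w i)) x ≡ fromℤ (+ sum (selected x w))
weight-fromℕ {N} w x = over id
  where
  selected-fromℕ : ∀ i → (if x i then fromℤ (+ w i) else 0ℚ) ≡ fromℤ (+ selected x w i)
  selected-fromℕ i with x i
  ... | true  = refl
  ... | false = refl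

  over : ∀ {m} (g : Fin m → Fin N) →
         foldr (λ i acc → (if x i then fromℤ (+ w i) else 0ℚ) ℚ.+ acc) 0ℚ (tabulate g)
           ≡ fromℤ (+ sum (selected x w ∘ g))
  over {zero}  g = refl
  over {suc m} g = begin
    _ ≡⟨ cong₂ ℚ._+_ (selected-fromℕ (g Fin.zero)) (over (g ∘ Fin.suc)) ⟩
    fromℤ (+ head) ℚ.+ fromℤ (+ rest) ≡⟨ fromℤ-homo-+ (+ head) (+ rest) ⟩
    fromℤ (+ head ℤ.+ + rest)        ≡⟨ cong fromℤ (ℤ.pos-+ head rest) ⟨
    fromℤ (+ (head + rest))          ∎
    where
    open ≡.≡-Reasoning
    head rest : ℕ
    head = selected x w (g Fin.zero)
    rest = sum (selected x w ∘ g ∘ Fin.suc)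

weight-≤-fromℕ : ∀ {N} (w : Fin N → ℕ) (x : Fin N → Bool) b →
                 (weight (λ i → fromℤ (+ w i)) x ℚ.≤ fromℤ (+ b)) ⇔ (sum (selected x w) ≤ b)
weight-≤-fromℕ w x b rewrite weight-fromℕ w x = fromℕ-≤

data Role (K : ℕ) : Set where
  independent : Fin K → Role K
  clique      : ℕ → Role K

Linked : ∀ {K} → Role K → Role K → Set
Linked (independent _) (independent _) = ⊥
Linked (independent a) (clique s)      = toℕ a < s
Linked (clique s)      (independent a) = toℕ a < s
Linked (clique _)      (clique _)      = ⊤

linked? : ∀ {K} (σ τ : Role K) → Dec (Linked σ τ)
linked? (independent _) (independent _) = no id
linked? (independent a) (clique s)      = toℕ a <? s
linked? (clique s)      (independent a) = toℕ a <? s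
linked? (clique _)      (clique _)      = yes tt

independent? : ∀ {K} (σ : Role K) → Dec (∃ λ a → σ ≡ independent a)
independent? (independent a) = yes (a , refl)
independent? (clique _)      = no λ ()

IsNestedSplit : ∀ {N K} → (Fin N → Fin N → Set) → (Fin N → Role K) → Set
IsNestedSplit R role = ∀ i j → i ≢ j → R i j ⇔ Linked (role i) (role j)

module NestedSplitWeights {N K} {R : Fin N → Fin N → Set} (role : Fin N → Role K)
                          (nested : IsNestedSplit R role) where
  D P b : ℕ
  D = suc N
  P = N * D ^ K
  b = suc (P + P)

  budget : Fin K → ℕ
  budget a = N * D ^ (K ∸ suc (toℕ a))

  roleWeight : Role K → ℕ
  roleWeight (independent a) = b ∸ budget a
  roleWeight (clique s)      = D ^ (K ∸ s)

  budget≤P : ∀ a → budget a ≤ P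
  budget≤P a = *-monoʳ-≤ N (^-monoʳ-≤ D (m∸n≤m K (suc (toℕ a))))

  P≤b : P ≤ b
  P≤b = ≤-trans (m≤m+n P P) (n≤1+n (P + P))

  independent-weight+budget : ∀ a → roleWeight (independent a) + budget a ≡ b
  independent-weight+budget a = m∸n+n≡m (≤-trans (budget≤P a) P≤b)

  P<independent-weight : ∀ a → P < roleWeight (independent a)
  P<independent-weight a = begin
    suc P          ≡⟨ m+n∸n≡m (suc P) P ⟨
    b ∸ P          ≤⟨ ∸-monoʳ-≤ b (budget≤P a) ⟩
    b ∸ budget a   ∎
    where open ≤-Reasoning

  budget<unlinked-weight : ∀ a s → ¬ toℕ a < s → budget a < roleWeight (clique s)
  budget<unlinked-weight a s a≮s = begin-strict
    N * D ^ r          <⟨ m<n+m (N * D ^ r) (m^n>0 D r) ⟩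
    D ^ suc r          ≡⟨ cong (D ^_) (+-∸-assoc 1 (toℕ<n a)) ⟨
    D ^ (K ∸ toℕ a)    ≤⟨ ^-monoʳ-≤ D (∸-monoʳ-≤ K (≮⇒≥ a≮s)) ⟩
    D ^ (K ∸ s)        ∎
    where
    open ≤-Reasoning
    r : ℕ
    r = K ∸ suc (toℕ a)

  unlinked-heavy : ∀ σ τ → ¬ Linked σ τ → b < roleWeight σ + roleWeight τ
  unlinked-heavy (independent a) (independent a') _ = begin-strict
    b                  <⟨ ≤-reflexive (cong suc (≡.sym (+-suc P P))) ⟩
    suc P + suc P      ≤⟨ +-mono-≤ (P<independent-weight a) (P<independent-weight a') ⟩
    roleWeight (independent a) + roleWeight (independent a') ∎
    where open ≤-Reasoning
  unlinked-heavy (independent a) (clique s) a≮s = begin-strict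
    b                                         ≡⟨ independent-weight+budget a ⟨
    roleWeight (independent a) + budget a     <⟨ +-monoʳ-< _ (budget<unlinked-weight a s a≮s) ⟩
    roleWeight (independent a) + roleWeight (clique s) ∎
    where open ≤-Reasoning
  unlinked-heavy (clique s) (independent a) a≮s =
    subst (b <_) (+-comm (roleWeight (independent a)) _) (unlinked-heavy (independent a) (clique s) a≮s)
  unlinked-heavy (clique _) (clique _) ¬⊤ = ⊥-elim (¬⊤ tt)

  linked-light : ∀ a τ → Linked (independent a) τ → roleWeight τ ≤ D ^ (K ∸ suc (toℕ a))
  linked-light a (clique s) a<s = ^-monoʳ-≤ D (∸-monoʳ-≤ K a<s)

  clique-light : ∀ s → roleWeight (clique s) ≤ D ^ K
  clique-light s = ^-monoʳ-≤ D (m∸n≤m K s)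

  W : Fin N → ℕ
  W v = roleWeight (role v)

  light⇒clique : ∀ x → sum (selected x W) ≤ b → IsClique R x
  light⇒clique x light i j i≢j xi xj with linked? (role i) (role j)
  ... | yes linked = from (nested i j i≢j) linked
  ... | no unlinked = ⊥-elim (<⇒≱ (unlinked-heavy (role i) (role j) unlinked) (begin
    W i + W j                        ≡⟨ cong₂ _+_ (selected-true x W xi) (selected-true x W xj) ⟨
    selected x W i + selected x W j  ≤⟨ +-≤-sum (selected x W) i≢j ⟩
    sum (selected x W)               ≤⟨ light ⟩
    b                                ∎))
    where open ≤-Reasoning

  clique⇒light : ∀ x → IsClique R x → sum (selected x W) ≤ b
  clique⇒light x isClique with any? (λ v → (x v ≟ᵇ true) ×-dec independent? (role v))
  ... | yes (v , xv , a , role-v) = begin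
    sum (selected x W)                 ≤⟨ sum-≤-+* (selected x W) v neighbour-light ⟩
    selected x W v + budget a          ≡⟨ cong (_+ budget a) (trans (selected-true x W xv) (cong roleWeight role-v)) ⟩
    roleWeight (independent a) + budget a ≡⟨ independent-weight+budget a ⟩
    b                                  ∎
    where
    open ≤-Reasoning
    neighbour-light : ∀ k → k ≢ v → selected x W k ≤ D ^ (K ∸ suc (toℕ a))
    neighbour-light k k≢v = selected-≤ x W k λ xk →
      linked-light a (role k)
        (subst (λ σ → Linked σ (role k)) role-v (to (nested v k (k≢v ∘ ≡.sym)) (isClique v k (k≢v ∘ ≡.sym) xv xk)))
  ... | no none = begin
    sum (selected x W)  ≤⟨ sum-≤-* (selected x W) (λ k → selected-≤ x W k (not-independent-light k)) ⟩
    P                   ≤⟨ P≤b ⟩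
    b                   ∎
    where
    open ≤-Reasoning
    not-independent-light : ∀ k → x k ≡ true → W k ≤ D ^ K
    not-independent-light k xk with role k in role-k
    ... | independent a = ⊥-elim (none (k , xk , a , role-k))
    ... | clique s      = clique-light s

nestedSplit⇒threshold : ∀ {N K} {R : Fin N → Fin N → Set} (role : Fin N → Role K) →
                        IsNestedSplit R role → IsThreshold R
nestedSplit⇒threshold role nested =
  (λ v → fromℤ (+ W v)) , fromℤ (+ b) , λ x → mk⇔
    (light⇒clique x ∘ to (weight-≤-fromℕ W x b))
    (from (weight-≤-fromℕ W x b) ∘ clique⇒light x)
  where open NestedSplitWeights role nested using (b; W; light⇒clique; clique⇒light)

≤-foldr-⊔ : ∀ {m xs} → m ∈ xs → m ≤ foldr _⊔_ 0 xs
≤-foldr-⊔ (here refl)            = m≤m⊔n _ _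
≤-foldr-⊔ {xs = y ∷ _} (there p) = ≤-trans (≤-foldr-⊔ p) (m≤n⊔m y _)

module _ {n t} (G : Graph n) (u : Fin t → Fin n) where

  neighbour<s : ∀ {v} j → T (adj G v (u j)) → toℕ j < s G u v
  neighbour<s {v} j v∼uj =
    subst (_≤ s G u v) (cong (λ c → if c then suc (toℕ j) else 0) (to T-≡ v∼uj))
          (≤-foldr-⊔ (∈-map⁺ (λ i → if adj G v (u i) then suc (toℕ i) else 0) (∈-allFin j)))

  TauAdj-sym : ∀ {x y} → TauAdj G u x y → TauAdj G u y x
  TauAdj-sym {x} {y} (inj₁ x∼y)                      = inj₁ (subst T (Graph.sym G x y) x∼y)
  TauAdj-sym (inj₂ (inj₁ (x∈B , y∈B , x≢y)))         = inj₂ (inj₁ (y∈B , x∈B , x≢y ∘ ≡.sym))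
  TauAdj-sym (inj₂ (inj₂ (inj₁ edge)))               = inj₂ (inj₂ (inj₂ edge))
  TauAdj-sym (inj₂ (inj₂ (inj₂ edge)))               = inj₂ (inj₂ (inj₁ edge))

  membership : ∀ v → (∃ λ j → u j ≡ v) ⊎ InB u v
  membership v with any? (λ j → u j ≟ᶠ v)
  ... | yes v∈A = inj₁ v∈A
  ... | no  v∉A = inj₂ λ j uj≡v → v∉A (j , uj≡v)

  roleBy : ∀ v → (∃ λ j → u j ≡ v) ⊎ InB u v → Role t
  roleBy v (inj₁ (j , _)) = independent j
  roleBy v (inj₂ _)       = clique (s G u v)

  τ-role : Fin n → Role t
  τ-role v = roleBy v (membership v)

  module _ (u-inj : Injective _≡_ _≡_ u) (A-independent : Independent G u) where

    A-A-nonadjacent : ∀ a a' → ¬ TauAdj G u (u a) (u a')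
    A-A-nonadjacent a a' (inj₁ ua∼ua')                       = subst T (A-independent a a') ua∼ua'
    A-A-nonadjacent a a' (inj₂ (inj₁ (ua∈B , _)))             = ua∈B a refl
    A-A-nonadjacent a a' (inj₂ (inj₂ (inj₁ (_ , ua∈B , _))))  = ua∈B a refl
    A-A-nonadjacent a a' (inj₂ (inj₂ (inj₂ (_ , ua'∈B , _)))) = ua'∈B a' refl

    B-A-adjacent⇒< : ∀ {v} a → InB u v → TauAdj G u v (u a) → toℕ a < s G u v
    B-A-adjacent⇒< a v∈B (inj₁ v∼ua)                         = neighbour<s a v∼ua
    B-A-adjacent⇒< a v∈B (inj₂ (inj₁ (_ , ua∈B , _)))          = ⊥-elim (ua∈B a refl)
    B-A-adjacent⇒< a v∈B (inj₂ (inj₂ (inj₁ (i , _ , ua≡ui , i<s)))) rewrite u-inj ua≡ui = i<s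
    B-A-adjacent⇒< a v∈B (inj₂ (inj₂ (inj₂ (_ , ua∈B , _))))   = ⊥-elim (ua∈B a refl)

    τ-nestedSplit : IsNestedSplit (TauAdj G u) τ-role
    τ-nestedSplit i j i≢j with membership i | membership j
    ... | inj₁ (a , refl) | inj₁ (a' , refl) = mk⇔ (A-A-nonadjacent a a') ⊥-elim
    ... | inj₁ (a , refl) | inj₂ j∈B =
      mk⇔ (B-A-adjacent⇒< a j∈B ∘ TauAdj-sym) (λ a<s → inj₂ (inj₂ (inj₂ (a , j∈B , refl , a<s))))
    ... | inj₂ i∈B | inj₁ (a , refl) =
      mk⇔ (B-A-adjacent⇒< a i∈B) (λ a<s → inj₂ (inj₂ (inj₁ (a , i∈B , refl , a<s))))
    ... | inj₂ i∈B | inj₂ j∈B = mk⇔ (λ _ → tt) (λ _ → inj₂ (inj₁ (i∈B , j∈B , i≢j)))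

proposition5 : ∀ {n t : ℕ} (G : Graph n) (u : Fin t → Fin n) →
                 Injective _≡_ _≡_ u → Independent G u →
                 IsThreshold (TauAdj G u) × IsSubgraphOf G (TauAdj G u)
proposition5 G u u-inj A-independent =
  nestedSplit⇒threshold (τ-role G u) (τ-nestedSplit G u u-inj A-independent) , λ _ _ → inj₁
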